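{- Let $G$ be a digraph such that $d^+_G(x)+d^-_G(x)\ge |G|+3$ for every vertex $x\in V(G)$ and $d^+_G(x)+d^-_G(y)\ge |G|+1$ for all vertices $x,y\in V(G)$. Let $z_1,z_2$ be distinct vertices of $G$ such that $z_1z_2\notin E(G)$. Then there exists a vertex $a\in N^+_G(z_1)\cap N^-_G(z_2)$ such that $G-\{z_1,z_2,a\}$ is strongly connected.
   Context: Digraphs have no loops and at most one edge in each direction between any pair of vertices. $|G|$ is the number of vertices of $G$; $N^+_G(x)$ and $N^-_G(x)$ are the sets of out- and in-neighbours of $x$ in $G$, and $d^\pm_G(x)=|N^\pm_G(x)|$. $z_1z_2$ denotes the edge directed from $z_1$ to $z_2$. -}

module Defs where

open import Data.Nat using (ℕ; zero; suc; _+_)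
open import Data.Fin using (Fin)
open import Data.Bool using (Bool; true; false)
open import Data.List using (List; filterᵇ; length; allFin)
open import Relation.Binary.PropositionalEquality using (_≡_; _≢_)
open import Relation.Nullary using (¬_)

-- A digraph on the vertex set Fin n, given by a Boolean adjacency relation:
-- adj x y ≡ true  means the edge x y (directed from x to y) is present.
-- A relation automatically has at most one edge in each direction; loops are
-- excluded by the field `loopless`.
record Digraph (n : ℕ) : Set where
  field
    adj      : Fin n → Fin n → Bool
    loopless : ∀ x → adj x x ≡ false
open Digraph public

∣_∣ᵥ : ∀ {n} → Digraph n → ℕ
∣_∣ᵥ {n} _ = n

outdeg : ∀ {n} → Digraph n → Fin n → ℕ
outdeg {n} G x = length (filterᵇ (λ y → adj G x y) (allFin n))

indeg : ∀ {n} → Digraph n → Fin n → ℕ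
indeg {n} G x = length (filterᵇ (λ y → adj G y x) (allFin n))

Edge : ∀ {n} → Digraph n → Fin n → Fin n → Set
Edge G x y = adj G x y ≡ true

data Walk {n} (G : Digraph n) (In : Fin n → Set) : Fin n → Fin n → Set where
  here : ∀ {u} → In u → Walk G In u u
  step : ∀ {u w v} → In u → Edge G u w → Walk G In w v → Walk G In u v

StronglyConnected : ∀ {n} → Digraph n → (Fin n → Set) → Set
StronglyConnected G In = ∀ u v → In u → In v → Walk G In u v

Minus3 : ∀ {n} → Fin n → Fin n → Fin n → Fin n → Set
Minus3 z₁ z₂ a v = v ≢ z₁ × v ≢ z₂ × v ≢ a
  where open import Data.Product using (_×_)

module Submission where

-- Let H = V(G) ∖ {z₁,z₂,a}, so |H| = n - 3.  The cross condition gives at least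
-- three candidate apexes in N⁺(z₁) ∩ N⁻(z₂); take two, a ≠ a′.  For each, either all
-- pairs of H are joined inside H by walks of length ≤ 3, or a far pair u, v splits H into
-- a cut (X, Y) (no edge from X to Y) of vertices one step from u / one step to v.  Degree
-- counting in a cut gives |X| + |Y| = n - 3, d⁺ ≥ |X| + 2 everywhere, X → a, d⁻ ≥ |Y| + 4
-- on X and |X| ≥ 2 (dually for Y); and cuts for a and a′ cannot coexist.

open import Defs
open import Data.Nat using (ℕ; zero; suc; _+_; _≤_; _<_; _≥_; z≤n; s≤s)
open import Data.Nat.Properties
  using ( +-assoc; +-comm; +-suc; +-identityʳ; +-mono-≤; +-monoˡ-≤; +-monoʳ-≤
        ; +-cancelˡ-≤; +-cancelʳ-≤; m+1+n≰m; m≤m+n; m≤n⇒m≤1+n; n≤1+n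
        ; ≤-antisym; ≤-pred; ≤-reflexive; ≤-trans; module ≤-Reasoning )
open import Data.Nat.Tactic.RingSolver using (solve-∀)
open import Data.Fin using (Fin; zero; suc; _≟_)
open import Data.Fin.Properties using (any?)
open import Data.Bool using (Bool; true; false; _∨_; _∧_; not; if_then_else_)
  renaming (_≟_ to _≟ᵇ_)
open import Data.Bool.Properties using (∨-zeroʳ)
open import Data.List using (List; []; _∷_; length; filterᵇ; tabulate)
open import Data.List.Relation.Unary.All using (All; []; _∷_)
open import Data.List.Relation.Unary.AllPairs using ([]; _∷_)
open import Data.List.Relation.Unary.Unique.Propositional using (Unique)
open import Data.Product using (Σ; ∃-syntax; _×_; _,_; proj₁; proj₂)
open import Data.Sum using (_⊎_; inj₁; inj₂; [_,_]; [_,_]′)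
open import Data.Empty using (⊥; ⊥-elim)
open import Function using (_∘_)
open import Relation.Nullary using (¬_; Dec; yes; no; does; _⊎-dec_; _×-dec_; ¬?)
open import Relation.Nullary.Decidable as Dec using (dec-true; decidable-stable)
open import Relation.Unary using (Pred; Decidable)
open import Relation.Binary.PropositionalEquality
  using (_≡_; _≢_; refl; sym; trans; cong; cong₂; subst; subst₂)
open ≤-Reasoning

VSet : ℕ → Set
VSet n = Fin n → Bool

infix 4 _∈_ _∉_ _⊆_ _∈?_
infixr 6 _∪_
infixr 7 _∩_

-- Membership is wrapped in a record so that Agda recovers the set from a membership
-- proof (a bare equation  S x ≡ true  would not determine S).
record _∈_ {n} (x : Fin n) (S : VSet n) : Set where
  constructor mem
  field member : S x ≡ true
open _∈_ public

_∉_ : ∀ {n} → Fin n → VSet n → Set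
x ∉ S = ¬ x ∈ S

_⊆_ : ∀ {n} → VSet n → VSet n → Set
S ⊆ T = ∀ {x} → x ∈ S → x ∈ T

Disjoint : ∀ {n} → VSet n → VSet n → Set
Disjoint S T = ∀ {x} → x ∈ S → x ∈ T → ⊥

_∈?_ : ∀ {n} (x : Fin n) (S : VSet n) → Dec (x ∈ S)
x ∈? S = Dec.map′ mem member (S x ≟ᵇ true)

∣_∣ : ∀ {n} → VSet n → ℕ
∣_∣ {zero} S = 0
∣_∣ {suc n} S = (if S zero then 1 else 0) + ∣ S ∘ suc ∣

-- Bridge to the list-based degrees of Defs (allFin n is tabulate of the identity).
filter-length : ∀ {A : Set} {m} (f : Fin m → A) (P : A → Bool) →
  length (filterᵇ P (tabulate f)) ≡ ∣ P ∘ f ∣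
filter-length {m = zero} f P = refl
filter-length {m = suc m} f P with P (f zero)
... | true = cong suc (filter-length (f ∘ suc) P)
... | false = filter-length (f ∘ suc) P

∣∣≡0 : ∀ {n} (S : VSet n) → (∀ {x} → x ∉ S) → ∣ S ∣ ≡ 0
∣∣≡0 {zero} S empty = refl
∣∣≡0 {suc n} S empty with S zero in eq
... | true = ⊥-elim (empty (mem eq))
... | false = ∣∣≡0 (S ∘ suc) λ (mem e) → empty (mem e)

-- The set operations are opaque: kept abstract, they unify by their arguments, and all
-- reasoning about them goes through the membership and counting lemmas of this block.
opaque
  ∅ : ∀ {n} → VSet n
  ∅ _ = false

  _∪_ _∩_ : ∀ {n} → VSet n → VSet n → VSet n
  (S ∪ T) x = S x ∨ T x
  (S ∩ T) x = S x ∧ T x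

  ∁ : ∀ {n} → VSet n → VSet n
  ∁ S x = not (S x)

  ⟪_⟫ : ∀ {n ℓ} {P : Pred (Fin n) ℓ} → Decidable P → VSet n
  ⟪ P? ⟫ x = does (P? x)

  ⁅_⁆ : ∀ {n} → Fin n → VSet n
  ⁅ z ⁆ = ⟪ _≟ z ⟫

  ∉∅ : ∀ {n} {x : Fin n} → x ∉ ∅
  ∉∅ (mem ())

  ∈⟪⟫⁺ : ∀ {n ℓ} {P : Pred (Fin n) ℓ} (P? : Decidable P) {x} → P x → x ∈ ⟪ P? ⟫
  ∈⟪⟫⁺ P? {x} p = mem (dec-true (P? x) p)

  ∈⟪⟫⁻ : ∀ {n ℓ} {P : Pred (Fin n) ℓ} (P? : Decidable P) {x} → x ∈ ⟪ P? ⟫ → P x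
  ∈⟪⟫⁻ {P = P} P? {x} (mem x∈) = from-does (P? x) x∈
    where
    from-does : (d : Dec (P x)) → does d ≡ true → P x
    from-does (yes p) _ = p

  ∈⁅⁆⁺ : ∀ {n} {x z : Fin n} → x ≡ z → x ∈ ⁅ z ⁆
  ∈⁅⁆⁺ {z = z} = ∈⟪⟫⁺ (_≟ z)

  ∈⁅⁆⁻ : ∀ {n} {x z : Fin n} → x ∈ ⁅ z ⁆ → x ≡ z
  ∈⁅⁆⁻ {z = z} = ∈⟪⟫⁻ (_≟ z)

  ∈∪ˡ : ∀ {n} {S T : VSet n} {x} → x ∈ S → x ∈ S ∪ T
  ∈∪ˡ {T = T} {x} (mem x∈S) = mem (cong (_∨ T x) x∈S)

  ∈∪ʳ : ∀ {n} {S T : VSet n} {x} → x ∈ T → x ∈ S ∪ T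
  ∈∪ʳ {S = S} {x = x} (mem x∈T) = mem (trans (cong (S x ∨_) x∈T) (∨-zeroʳ (S x)))

  ∈∪⁻ : ∀ {n} {S T : VSet n} {x} → x ∈ S ∪ T → x ∈ S ⊎ x ∈ T
  ∈∪⁻ {S = S} {T} {x} (mem x∈) with S x in eq
  ... | true = inj₁ (mem eq)
  ... | false = inj₂ (mem x∈)

  ∈∩⁺ : ∀ {n} {S T : VSet n} {x} → x ∈ S → x ∈ T → x ∈ S ∩ T
  ∈∩⁺ (mem x∈S) (mem x∈T) = mem (cong₂ _∧_ x∈S x∈T)

  ∈∩⁻ : ∀ {n} {S T : VSet n} {x} → x ∈ S ∩ T → x ∈ S × x ∈ T
  ∈∩⁻ {S = S} {T} {x} (mem x∈) with S x in eS | T x in eT | x∈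
  ... | true | true | _ = mem eS , mem eT

  ∈∁⁺ : ∀ {n} {S : VSet n} {x} → x ∉ S → x ∈ ∁ S
  ∈∁⁺ {S = S} {x} x∉S with S x in eq
  ... | true = ⊥-elim (x∉S (mem eq))
  ... | false = mem (cong not eq)

  ∈∁⁻ : ∀ {n} {S : VSet n} {x} → x ∈ ∁ S → x ∉ S
  ∈∁⁻ (mem x∈) (mem x∈S) with () ← trans (sym (cong not x∈S)) x∈

  ∣∪∣+∣∩∣ : ∀ {n} (S T : VSet n) → ∣ S ∪ T ∣ + ∣ S ∩ T ∣ ≡ ∣ S ∣ + ∣ T ∣
  ∣∪∣+∣∩∣ {zero} S T = refl
  ∣∪∣+∣∩∣ {suc n} S T with S zero | T zero | ∣∪∣+∣∩∣ (S ∘ suc) (T ∘ suc)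
  ... | true  | true  | ih = cong suc (trans (+-suc _ _) (trans (cong suc ih) (sym (+-suc _ _))))
  ... | true  | false | ih = cong suc ih
  ... | false | true  | ih = trans (cong suc ih) (sym (+-suc _ _))
  ... | false | false | ih = ih

  ∣⁅⁆∣ : ∀ {n} (z : Fin n) → ∣ ⁅ z ⁆ ∣ ≡ 1
  ∣⁅⁆∣ {suc n} zero = cong suc (∣∣≡0 {n} (⁅ zero ⁆ ∘ suc) λ { (mem ()) })
  ∣⁅⁆∣ {suc n} (suc z) = ∣⁅⁆∣ z

⟦_⟧ : ∀ {n} → List (Fin n) → VSet n
⟦ [] ⟧ = ∅
⟦ z ∷ zs ⟧ = ⁅ z ⁆ ∪ ⟦ zs ⟧

∣∣-mono : ∀ {n} {S T : VSet n} → S ⊆ T → ∣ S ∣ ≤ ∣ T ∣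
∣∣-mono {zero} S⊆T = z≤n
∣∣-mono {suc n} {S} {T} S⊆T with S zero in eS | T zero in eT
... | true  | true  = s≤s (∣∣-mono tail⊆)
  where tail⊆ : S ∘ suc ⊆ T ∘ suc
        tail⊆ (mem e) = mem (member (S⊆T (mem e)))
... | true  | false with () ← trans (sym (member (S⊆T (mem eS)))) eT
... | false | true  = m≤n⇒m≤1+n (∣∣-mono tail⊆)
  where tail⊆ : S ∘ suc ⊆ T ∘ suc
        tail⊆ (mem e) = mem (member (S⊆T (mem e)))
... | false | false = ∣∣-mono tail⊆
  where tail⊆ : S ∘ suc ⊆ T ∘ suc
        tail⊆ (mem e) = mem (member (S⊆T (mem e)))

∣∣≤n : ∀ {n} (S : VSet n) → ∣ S ∣ ≤ n
∣∣≤n {zero} S = z≤n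
∣∣≤n {suc n} S with S zero
... | true = s≤s (∣∣≤n (S ∘ suc))
... | false = m≤n⇒m≤1+n (∣∣≤n (S ∘ suc))

∣∪∣≤ : ∀ {n} (S T : VSet n) → ∣ S ∪ T ∣ ≤ ∣ S ∣ + ∣ T ∣
∣∪∣≤ S T = ≤-trans (m≤m+n _ _) (≤-reflexive (∣∪∣+∣∩∣ S T))

∣∪∣-disjoint : ∀ {n} {S T : VSet n} → Disjoint S T → ∣ S ∪ T ∣ ≡ ∣ S ∣ + ∣ T ∣
∣∪∣-disjoint {S = S} {T} disjoint = begin-equality
  ∣ S ∪ T ∣               ≡⟨ sym (+-identityʳ _) ⟩
  ∣ S ∪ T ∣ + 0           ≡⟨ cong (∣ S ∪ T ∣ +_) (sym (∣∣≡0 (S ∩ T) no-common)) ⟩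
  ∣ S ∪ T ∣ + ∣ S ∩ T ∣   ≡⟨ ∣∪∣+∣∩∣ S T ⟩
  ∣ S ∣ + ∣ T ∣           ∎
  where
  no-common : ∀ {x} → x ∉ S ∩ T
  no-common x∈ = let (x∈S , x∈T) = ∈∩⁻ x∈ in disjoint x∈S x∈T

nonempty : ∀ {n} (S : VSet n) → 1 ≤ ∣ S ∣ → ∃[ x ] x ∈ S
nonempty {suc n} S h with S zero in eq
... | true = zero , mem eq
... | false = let (x , mem x∈) = nonempty (S ∘ suc) h in suc x , mem x∈

another : ∀ {n} (S : VSet n) → 2 ≤ ∣ S ∣ → ∀ z → ∃[ x ] (x ∈ S × x ≢ z)
another S two z =
  let (x , x∈) = nonempty (S ∩ ∁ ⁅ z ⁆) (+-cancelʳ-≤ 1 1 _ (begin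
        2                              ≤⟨ two ⟩
        ∣ S ∣                          ≤⟨ ∣∣-mono split ⟩
        ∣ S ∩ ∁ ⁅ z ⁆ ∪ ⁅ z ⁆ ∣        ≤⟨ ∣∪∣≤ _ ⁅ z ⁆ ⟩
        ∣ S ∩ ∁ ⁅ z ⁆ ∣ + ∣ ⁅ z ⁆ ∣    ≡⟨ cong (∣ S ∩ ∁ ⁅ z ⁆ ∣ +_) (∣⁅⁆∣ z) ⟩
        ∣ S ∩ ∁ ⁅ z ⁆ ∣ + 1            ∎))
      (x∈S , x∉⁅z⁆) = ∈∩⁻ x∈
  in x , x∈S , λ x≡z → ∈∁⁻ x∉⁅z⁆ (∈⁅⁆⁺ x≡z)
  where
  split : S ⊆ S ∩ ∁ ⁅ z ⁆ ∪ ⁅ z ⁆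
  split {x} x∈S with x ≟ z
  ... | yes x≡z = ∈∪ʳ (∈⁅⁆⁺ x≡z)
  ... | no x≢z = ∈∪ˡ (∈∩⁺ x∈S (∈∁⁺ (x≢z ∘ ∈⁅⁆⁻)))

∉⟦⟧ : ∀ {n} {x : Fin n} {zs} → All (x ≢_) zs → x ∉ ⟦ zs ⟧
∉⟦⟧ [] = ∉∅
∉⟦⟧ {zs = z ∷ zs} (x≢z ∷ x≢zs) x∈ with ∈∪⁻ x∈
... | inj₁ x∈⁅z⁆ = x≢z (∈⁅⁆⁻ x∈⁅z⁆)
... | inj₂ x∈zs = ∉⟦⟧ x≢zs x∈zs

∣⟦⟧∣ : ∀ {n} {zs : List (Fin n)} → Unique zs → ∣ ⟦ zs ⟧ ∣ ≡ length zs
∣⟦⟧∣ {n} {zs = []} [] = ∣∣≡0 (∅ {n}) ∉∅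
∣⟦⟧∣ {zs = z ∷ zs} (z∉zs ∷ unique) =
  trans (∣∪∣-disjoint {S = ⁅ z ⁆} {⟦ zs ⟧} head-new) (cong₂ _+_ (∣⁅⁆∣ z) (∣⟦⟧∣ unique))
  where
  head-new : Disjoint ⁅ z ⁆ ⟦ zs ⟧
  head-new x∈⁅z⁆ x∈zs = ∉⟦⟧ z∉zs (subst (_∈ ⟦ zs ⟧) (∈⁅⁆⁻ x∈⁅z⁆) x∈zs)

first-two : ∀ {n} {x y z : Fin n} → Unique (x ∷ y ∷ z ∷ []) → Unique (x ∷ y ∷ [])
first-two ((x≢y ∷ _) ∷ _) = (x≢y ∷ []) ∷ [] ∷ []

last≢ : ∀ {n} {x y z : Fin n} → Unique (x ∷ y ∷ z ∷ []) → z ≢ x × z ≢ y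
last≢ ((_ ∷ x≢z ∷ []) ∷ (y≢z ∷ []) ∷ _) = x≢z ∘ sym , y≢z ∘ sym

N⁺ N⁻ : ∀ {n} → Digraph n → Fin n → VSet n
N⁺ G x = adj G x
N⁻ G x y = adj G y x

d⁺ d⁻ : ∀ {n} → Digraph n → Fin n → ℕ
d⁺ G x = ∣ N⁺ G x ∣
d⁻ G x = ∣ N⁻ G x ∣

outdeg≡d⁺ : ∀ {n} (G : Digraph n) x → outdeg G x ≡ d⁺ G x
outdeg≡d⁺ G x = filter-length (λ y → y) (adj G x)

indeg≡d⁻ : ∀ {n} (G : Digraph n) x → indeg G x ≡ d⁻ G x
indeg≡d⁻ G x = filter-length (λ y → y) (λ y → adj G y x)

-- Reversing all edges; d⁺ and d⁻ swap definitionally, which halves every argument below.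
rev : ∀ {n} → Digraph n → Digraph n
rev G = record { adj = λ x y → adj G y x ; loopless = loopless G }

MinDegree CrossDegree : ∀ {n} → Digraph n → Set
MinDegree {n} G = ∀ x → n + 3 ≤ d⁺ G x + d⁻ G x
CrossDegree {n} G = ∀ x y → n + 1 ≤ d⁺ G x + d⁻ G y

rev-MinDegree : ∀ {n} (G : Digraph n) → MinDegree G → MinDegree (rev G)
rev-MinDegree {n} G min x = subst (n + 3 ≤_) (+-comm (d⁺ G x) (d⁻ G x)) (min x)

rev-CrossDegree : ∀ {n} (G : Digraph n) → CrossDegree G → CrossDegree (rev G)
rev-CrossDegree {n} G cross x y = subst (n + 1 ≤_) (+-comm (d⁺ G y) (d⁻ G x)) (cross y x)

edge⇒≢ : ∀ {n} (G : Digraph n) {x y} → Edge G x y → x ≢ y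
edge⇒≢ G {x} e refl with () ← trans (sym e) (loopless G x)

-- Loops are absent, so a set containing x and all its out-neighbours exceeds d⁺(x).
out-degree-bound : ∀ {n} (G : Digraph n) {x} {T : VSet n} →
  N⁺ G x ⊆ T → x ∈ T → d⁺ G x < ∣ T ∣
out-degree-bound G {x} {T} N⁺⊆T x∈T = begin
  suc (d⁺ G x)                ≡⟨ +-comm 1 (d⁺ G x) ⟩
  d⁺ G x + 1                  ≡⟨ cong (d⁺ G x +_) (sym (∣⁅⁆∣ x)) ⟩
  ∣ N⁺ G x ∣ + ∣ ⁅ x ⁆ ∣      ≡⟨ sym (∣∪∣-disjoint no-loop) ⟩
  ∣ N⁺ G x ∪ ⁅ x ⁆ ∣          ≤⟨ ∣∣-mono inside ⟩
  ∣ T ∣                       ∎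
  where
  no-loop : Disjoint (N⁺ G x) ⁅ x ⁆
  no-loop (mem e) w∈⁅x⁆ = edge⇒≢ G e (sym (∈⁅⁆⁻ w∈⁅x⁆))
  inside : N⁺ G x ∪ ⁅ x ⁆ ⊆ T
  inside w∈ with ∈∪⁻ w∈
  ... | inj₁ w∈N⁺ = N⁺⊆T w∈N⁺
  ... | inj₂ w∈⁅x⁆ = subst (_∈ T) (sym (∈⁅⁆⁻ w∈⁅x⁆)) x∈T

d⁺<n : ∀ {n} (G : Digraph n) x → d⁺ G x < n
d⁺<n G x = ≤-trans (out-degree-bound G {T = λ _ → true} (λ _ → mem refl) (mem refl)) (∣∣≤n _)

out-bound-via : ∀ {n} (G : Digraph n) {x} {A : VSet n} {zs} → Unique zs →
  x ∈ A → N⁺ G x ⊆ A ∪ ⟦ zs ⟧ → d⁺ G x < ∣ A ∣ + length zs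
out-bound-via G {x} {A} {zs} unique x∈A N⁺⊆ = begin
  suc (d⁺ G x)            ≤⟨ out-degree-bound G N⁺⊆ (∈∪ˡ x∈A) ⟩
  ∣ A ∪ ⟦ zs ⟧ ∣          ≤⟨ ∣∪∣≤ A ⟦ zs ⟧ ⟩
  ∣ A ∣ + ∣ ⟦ zs ⟧ ∣      ≡⟨ cong (∣ A ∣ +_) (∣⟦⟧∣ unique) ⟩
  ∣ A ∣ + length zs       ∎

<+suc⇒≤ : ∀ {m} k {l} → m < k + suc l → m ≤ k + l
<+suc⇒≤ {m} k {l} m<k+1+l = ≤-pred (subst (m <_) (+-suc k l) m<k+1+l)

cross-bound : ∀ {n} (G : Digraph n) → CrossDegree G → ∀ {u v α β} →
  d⁺ G u ≤ α + 2 → d⁻ G v ≤ β + 2 → n ≤ α + β + 3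
cross-bound {n} G cross {u} {v} {α} {β} out-u in-v = +-cancelʳ-≤ 1 n (α + β + 3) (begin
  n + 1                 ≤⟨ cross u v ⟩
  d⁺ G u + d⁻ G v       ≤⟨ +-mono-≤ out-u in-v ⟩
  (α + 2) + (β + 2)     ≡⟨ shuffle α β ⟩
  α + β + 3 + 1         ∎)
  where
  shuffle : ∀ x y → (x + 2) + (y + 2) ≡ x + y + 3 + 1
  shuffle = solve-∀

walk-map : ∀ {n} {G : Digraph n} {P Q : Fin n → Set} → (∀ {w} → P w → Q w) →
  ∀ {u v} → Walk G P u v → Walk G Q u v
walk-map P⇒Q (here u∈P) = here (P⇒Q u∈P)
walk-map P⇒Q (step u∈P e walk) = step (P⇒Q u∈P) e (walk-map P⇒Q walk)

module Reachability {n} (G : Digraph n) (S : VSet n) where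

  -- Reach k u v: a walk from u to v with at most k edges, all vertices after u in S.
  Reach : ℕ → Fin n → Fin n → Set
  Reach zero u v = u ≡ v
  Reach (suc k) u v = Reach k u v ⊎ ∃[ w ] (w ∈ S × Edge G u w × Reach k w v)

  reach-refl : ∀ k {u} → Reach k u u
  reach-refl zero = refl
  reach-refl (suc k) = inj₁ (reach-refl k)

  reach-edge : ∀ {u v} → v ∈ S → Edge G u v → Reach 1 u v
  reach-edge v∈S e = inj₂ (_ , v∈S , e , refl)

  reach-++ : ∀ j {k u w v} → Reach j u w → Reach k w v → Reach (j + k) u v
  reach-++ zero refl r = r
  reach-++ (suc j) (inj₁ r₁) r₂ = inj₁ (reach-++ j r₁ r₂)
  reach-++ (suc j) (inj₂ (x , x∈S , e , r₁)) r₂ = inj₂ (x , x∈S , e , reach-++ j r₁ r₂)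

  reach? : ∀ k u v → Dec (Reach k u v)
  reach? zero u v = u ≟ v
  reach? (suc k) u v =
    reach? k u v ⊎-dec any? λ w → (w ∈? S) ×-dec (adj G u w ≟ᵇ true) ×-dec reach? k w v

  reach⇒walk : ∀ k {u v} → u ∈ S → v ∈ S → Reach k u v → Walk G (_∈ S) u v
  reach⇒walk zero u∈S _ refl = here u∈S
  reach⇒walk (suc k) u∈S v∈S (inj₁ r) = reach⇒walk k u∈S v∈S r
  reach⇒walk (suc k) u∈S v∈S (inj₂ (w , w∈S , e , r)) = step u∈S e (reach⇒walk k w∈S v∈S r)

  close-or-far : (∀ {u v} → u ∈ S → v ∈ S → Reach 3 u v)
               ⊎ ∃[ u ] ∃[ v ] (u ∈ S × v ∈ S × ¬ Reach 3 u v)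
  close-or-far with any? (λ u → any? λ v → (u ∈? S) ×-dec (v ∈? S) ×-dec ¬? (reach? 3 u v))
  ... | yes far-pair = inj₂ far-pair
  ... | no no-far-pair = inj₁ λ {u} {v} u∈S v∈S →
    decidable-stable (reach? 3 u v) λ far → no-far-pair (u , v , u∈S , v∈S , far)

  -- For a pair at distance > 3, the vertices of S within one step from u (X) and within
  -- one step to v (Y) are disjoint and no edge leads from X to Y.
  module Separation {u v} (u∈S : u ∈ S) (v∈S : v ∈ S) (far : ¬ Reach 3 u v) where

    X Y : VSet n
    X = S ∩ ⟪ reach? 1 u ⟫
    Y = S ∩ ⟪ (λ w → reach? 1 w v) ⟫

    X⊆S : X ⊆ S
    X⊆S = proj₁ ∘ ∈∩⁻

    Y⊆S : Y ⊆ S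
    Y⊆S = proj₁ ∘ ∈∩⁻

    near-u : ∀ {w} → w ∈ X → Reach 1 u w
    near-u = ∈⟪⟫⁻ (reach? 1 u) ∘ proj₂ ∘ ∈∩⁻

    near-v : ∀ {w} → w ∈ Y → Reach 1 w v
    near-v = ∈⟪⟫⁻ (λ w → reach? 1 w v) ∘ proj₂ ∘ ∈∩⁻

    u∈X : u ∈ X
    u∈X = ∈∩⁺ u∈S (∈⟪⟫⁺ (reach? 1 u) (reach-refl 1))

    v∈Y : v ∈ Y
    v∈Y = ∈∩⁺ v∈S (∈⟪⟫⁺ (λ w → reach? 1 w v) (reach-refl 1))

    out-u : ∀ {w} → w ∈ S → Edge G u w → w ∈ X
    out-u w∈S e = ∈∩⁺ w∈S (∈⟪⟫⁺ (reach? 1 u) (reach-edge w∈S e))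

    in-v : ∀ {w} → w ∈ S → Edge G w v → w ∈ Y
    in-v w∈S e = ∈∩⁺ w∈S (∈⟪⟫⁺ (λ w → reach? 1 w v) (reach-edge v∈S e))

    disjoint : Disjoint X Y
    disjoint w∈X w∈Y = far (inj₁ (reach-++ 1 (near-u w∈X) (near-v w∈Y)))

    no-edge : ∀ {x y} → x ∈ X → y ∈ Y → ¬ Edge G x y
    no-edge x∈X y∈Y e = far (reach-++ 1 (near-u x∈X) (inj₂ (_ , Y⊆S y∈Y , e , near-v y∈Y)))

-- A cut of S: a partition of S into nonempty parts X, Y with no edge from X to Y.
-- Its existence is exactly the failure of strong connectivity of G[S].
record Cut {n} (G : Digraph n) (S : VSet n) : Set where
  field
    X Y      : VSet n
    X⊆S      : X ⊆ S
    Y⊆S      : Y ⊆ S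
    disjoint : Disjoint X Y
    cover    : ∀ {w} → w ∈ S → w ∈ X ⊎ w ∈ Y
    no-edge  : ∀ {x y} → x ∈ X → y ∈ Y → ¬ Edge G x y
    u v      : Fin n
    u∈X      : u ∈ X
    v∈Y      : v ∈ Y

  X-closed : ∀ {x w} → x ∈ X → w ∈ S → Edge G x w → w ∈ X
  X-closed x∈X w∈S e with cover w∈S
  ... | inj₁ w∈X = w∈X
  ... | inj₂ w∈Y = ⊥-elim (no-edge x∈X w∈Y e)

reverse : ∀ {n} {G : Digraph n} {S} → Cut G S → Cut (rev G) S
reverse K = record
  { X = Y ; Y = X ; X⊆S = Y⊆S ; Y⊆S = X⊆S
  ; disjoint = λ w∈Y w∈X → disjoint w∈X w∈Y
  ; cover = Data.Sum.swap ∘ cover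
  ; no-edge = λ y∈Y x∈X → no-edge x∈X y∈Y
  ; u = v ; v = u ; u∈X = v∈Y ; v∈Y = u∈X }
  where open Cut K

module Deletion {n} {z₁ z₂ a : Fin n} (distinct : Unique (z₁ ∷ z₂ ∷ a ∷ [])) where

  Z H : VSet n
  Z = ⟦ z₁ ∷ z₂ ∷ a ∷ [] ⟧
  H = ∁ Z

  H⇒Minus3 : ∀ {x} → x ∈ H → Minus3 z₁ z₂ a x
  H⇒Minus3 x∈H =
      (λ x≡z₁ → ∈∁⁻ x∈H (∈∪ˡ (∈⁅⁆⁺ x≡z₁)))
    , (λ x≡z₂ → ∈∁⁻ x∈H (∈∪ʳ (∈∪ˡ (∈⁅⁆⁺ x≡z₂))))
    , (λ x≡a  → ∈∁⁻ x∈H (∈∪ʳ (∈∪ʳ (∈∪ˡ (∈⁅⁆⁺ x≡a)))))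

  Minus3⇒H : ∀ {x} → Minus3 z₁ z₂ a x → x ∈ H
  Minus3⇒H (x≢z₁ , x≢z₂ , x≢a) = ∈∁⁺ (∉⟦⟧ (x≢z₁ ∷ x≢z₂ ∷ x≢a ∷ []))

  room : ∀ {A B : VSet n} → A ⊆ H → B ⊆ H → Disjoint A B → ∣ A ∣ + ∣ B ∣ + 3 ≤ n
  room {A} {B} A⊆H B⊆H A#B = begin
    ∣ A ∣ + ∣ B ∣ + 3         ≡⟨ cong₂ _+_ (sym (∣∪∣-disjoint A#B)) (sym (∣⟦⟧∣ distinct)) ⟩
    ∣ A ∪ B ∣ + ∣ Z ∣         ≡⟨ sym (∣∪∣-disjoint outside-Z) ⟩
    ∣ (A ∪ B) ∪ Z ∣           ≤⟨ ∣∣≤n _ ⟩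
    n                         ∎
    where
    outside-Z : Disjoint (A ∪ B) Z
    outside-Z w∈A∪B w∈Z with ∈∪⁻ w∈A∪B
    ... | inj₁ w∈A = ∈∁⁻ (A⊆H w∈A) w∈Z
    ... | inj₂ w∈B = ∈∁⁻ (B⊆H w∈B) w∈Z

  fill : ∀ {A B : VSet n} → A ⊆ H → B ⊆ H → Disjoint A B → n ≤ ∣ A ∣ + ∣ B ∣ + 3 →
    ∀ {w} → w ∈ H → w ∈ A ⊎ w ∈ B
  fill {A} {B} A⊆H B⊆H A#B full {w} w∈H with w ∈? A | w ∈? B
  ... | yes w∈A | _       = inj₁ w∈A
  ... | no _    | yes w∈B = inj₂ w∈B
  ... | no w∉A  | no w∉B  = ⊥-elim (m+1+n≰m n (begin
    n + 1                           ≤⟨ +-monoˡ-≤ 1 full ⟩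
    ∣ A ∣ + ∣ B ∣ + 3 + 1           ≡⟨ shuffle ∣ A ∣ ∣ B ∣ ⟩
    ∣ A ∣ + (∣ B ∣ + 1) + 3         ≡⟨ cong (λ k → ∣ A ∣ + k + 3) (sym ∣B∪⁅w⁆∣) ⟩
    ∣ A ∣ + ∣ B ∪ ⁅ w ⁆ ∣ + 3       ≤⟨ room A⊆H B∪⁅w⁆⊆H A#B∪⁅w⁆ ⟩
    n                               ∎))
    where
    shuffle : ∀ x y → x + y + 3 + 1 ≡ x + (y + 1) + 3
    shuffle = solve-∀
    ∣B∪⁅w⁆∣ : ∣ B ∪ ⁅ w ⁆ ∣ ≡ ∣ B ∣ + 1
    ∣B∪⁅w⁆∣ = trans (∣∪∣-disjoint λ y∈B y∈⁅w⁆ → w∉B (subst (_∈ B) (∈⁅⁆⁻ y∈⁅w⁆) y∈B))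
                    (cong (∣ B ∣ +_) (∣⁅⁆∣ w))
    B∪⁅w⁆⊆H : B ∪ ⁅ w ⁆ ⊆ H
    B∪⁅w⁆⊆H y∈ with ∈∪⁻ y∈
    ... | inj₁ y∈B = B⊆H y∈B
    ... | inj₂ y∈⁅w⁆ = subst (_∈ H) (sym (∈⁅⁆⁻ y∈⁅w⁆)) w∈H
    A#B∪⁅w⁆ : Disjoint A (B ∪ ⁅ w ⁆)
    A#B∪⁅w⁆ x∈A x∈ with ∈∪⁻ x∈
    ... | inj₁ x∈B = A#B x∈A x∈B
    ... | inj₂ x∈⁅w⁆ = w∉A (subst (_∈ A) (∈⁅⁆⁻ x∈⁅w⁆) x∈A)

  out-bound : ∀ (G : Digraph n) {x} {A : VSet n} → x ∈ A →
    (∀ {w} → w ∈ H → Edge G x w → w ∈ A) → d⁺ G x ≤ ∣ A ∣ + 2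
  out-bound G {x} {A} x∈A closed = <+suc⇒≤ ∣ A ∣ (out-bound-via G distinct x∈A N⁺⊆)
    where
    N⁺⊆ : N⁺ G x ⊆ A ∪ Z
    N⁺⊆ {w} (mem e) with w ∈? Z
    ... | yes w∈Z = ∈∪ʳ w∈Z
    ... | no w∉Z = ∈∪ˡ (closed (∈∁⁺ w∉Z) e)

  out-bound-avoiding-a : ∀ (G : Digraph n) {x} {A : VSet n} → x ∈ A →
    (∀ {w} → w ∈ H → Edge G x w → w ∈ A) → ¬ Edge G x a → d⁺ G x ≤ ∣ A ∣ + 1
  out-bound-avoiding-a G {x} {A} x∈A closed x↛a =
    <+suc⇒≤ ∣ A ∣ (out-bound-via G (first-two distinct) x∈A N⁺⊆)
    where
    N⁺⊆ : N⁺ G x ⊆ A ∪ ⟦ z₁ ∷ z₂ ∷ [] ⟧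
    N⁺⊆ {w} (mem e) with w ≟ z₁ | w ≟ z₂ | w ≟ a
    ... | yes refl | _        | _        = ∈∪ʳ (∈∪ˡ (∈⁅⁆⁺ refl))
    ... | no _     | yes refl | _        = ∈∪ʳ (∈∪ʳ (∈∪ˡ (∈⁅⁆⁺ refl)))
    ... | no _     | no _     | yes refl = ⊥-elim (x↛a e)
    ... | no w≢z₁  | no w≢z₂  | no w≢a   = ∈∪ˡ (closed (Minus3⇒H (w≢z₁ , w≢z₂ , w≢a)) e)

  -- The separation of a far pair covers H, by the cross condition and `fill`.
  cut-of-far-pair : ∀ (G : Digraph n) → CrossDegree G → ∀ {u v} → u ∈ H → v ∈ H →
    ¬ Reachability.Reach G H 3 u v → Cut G H
  cut-of-far-pair G cross {u} {v} u∈H v∈H far = record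
    { X = X ; Y = Y ; X⊆S = X⊆S ; Y⊆S = Y⊆S ; disjoint = disjoint
    ; cover = fill X⊆S Y⊆S disjoint full
    ; no-edge = no-edge ; u = u ; v = v ; u∈X = u∈X ; v∈Y = v∈Y }
    where
    open Reachability.Separation G H u∈H v∈H far
    full : n ≤ ∣ X ∣ + ∣ Y ∣ + 3
    full = cross-bound G cross (out-bound G u∈X out-u) (out-bound (rev G) v∈Y in-v)

  connected-or-cut : ∀ (G : Digraph n) → CrossDegree G →
    StronglyConnected G (Minus3 z₁ z₂ a) ⊎ Cut G H
  connected-or-cut G cross = Data.Sum.map connected cut close-or-far
    where
    open Reachability G H
    connected : (∀ {u v} → u ∈ H → v ∈ H → Reach 3 u v) → StronglyConnected G (Minus3 z₁ z₂ a)
    connected close u v u∈ v∈ = walk-map H⇒Minus3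
      (reach⇒walk 3 (Minus3⇒H u∈) (Minus3⇒H v∈) (close (Minus3⇒H u∈) (Minus3⇒H v∈)))
    cut : ∃[ u ] ∃[ v ] (u ∈ H × v ∈ H × ¬ Reach 3 u v) → Cut G H
    cut (u , v , u∈H , v∈H , far) = cut-of-far-pair G cross u∈H v∈H far

  cut-out-bound : ∀ (G : Digraph n) (K : Cut G H) {x} → x ∈ Cut.X K → d⁺ G x ≤ ∣ Cut.X K ∣ + 2
  cut-out-bound G K x∈X = out-bound G x∈X (Cut.X-closed K x∈X)

  module CutFacts (G : Digraph n) (min : MinDegree G) (cross : CrossDegree G) (K : Cut G H) where
    open Cut K public

    p q : ℕ
    p = ∣ X ∣
    q = ∣ Y ∣

    out-X : ∀ {x} → x ∈ X → d⁺ G x ≤ p + 2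
    out-X = cut-out-bound G K

    in-Y : ∀ {y} → y ∈ Y → d⁻ G y ≤ q + 2
    in-Y = cut-out-bound (rev G) (reverse K)

    size : p + q + 3 ≡ n
    size = ≤-antisym (room X⊆S Y⊆S disjoint) (cross-bound G cross (out-X u∈X) (in-Y v∈Y))

    out-all : ∀ w → p + 2 ≤ d⁺ G w
    out-all w = +-cancelʳ-≤ (q + 2) (p + 2) (d⁺ G w) (begin
      p + 2 + (q + 2)       ≡⟨ shuffle p q ⟩
      p + q + 3 + 1         ≡⟨ cong (_+ 1) size ⟩
      n + 1                 ≤⟨ cross w v ⟩
      d⁺ G w + d⁻ G v       ≤⟨ +-monoʳ-≤ (d⁺ G w) (in-Y v∈Y) ⟩
      d⁺ G w + (q + 2)      ∎)
      where
      shuffle : ∀ x y → x + 2 + (y + 2) ≡ x + y + 3 + 1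
      shuffle = solve-∀

    -- Hence out-X is tight, and in particular each x ∈ X sees a.
    X→a : ∀ {x} → x ∈ X → Edge G x a
    X→a {x} x∈X = decidable-stable (adj G x a ≟ᵇ true) λ x↛a →
      2≰1 (+-cancelˡ-≤ p 2 1 (≤-trans (out-all x) (out-bound-avoiding-a G x∈X (X-closed x∈X) x↛a)))
      where
      2≰1 : ¬ 2 ≤ 1
      2≰1 (s≤s ())

    in-X : ∀ {x} → x ∈ X → q + 4 ≤ d⁻ G x
    in-X {x} x∈X = +-cancelˡ-≤ (p + 2) (q + 4) (d⁻ G x) (begin
      p + 2 + (q + 4)       ≡⟨ shuffle p q ⟩
      p + q + 3 + 3         ≡⟨ cong (_+ 3) size ⟩
      n + 3                 ≤⟨ min x ⟩
      d⁺ G x + d⁻ G x       ≤⟨ +-monoˡ-≤ (d⁻ G x) (out-X x∈X) ⟩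
      p + 2 + d⁻ G x        ∎)
      where
      shuffle : ∀ x y → x + 2 + (y + 4) ≡ x + y + 3 + 3
      shuffle = solve-∀

    X-large : 2 ≤ p
    X-large = +-cancelˡ-≤ (q + 3) 2 p (begin
      q + 3 + 2       ≡⟨ shuffle q ⟩
      suc (q + 4)     ≤⟨ s≤s (in-X u∈X) ⟩
      suc (d⁻ G u)    ≤⟨ d⁺<n (rev G) u ⟩
      n               ≡⟨ sym size ⟩
      p + q + 3       ≡⟨ shuffle′ p q ⟩
      q + 3 + p       ∎)
      where
      shuffle : ∀ x → x + 3 + 2 ≡ suc (x + 4)
      shuffle = solve-∀
      shuffle′ : ∀ x y → x + y + 3 ≡ y + 3 + x
      shuffle′ = solve-∀

cuts-clash : ∀ {n} (G : Digraph n) → MinDegree G → CrossDegree G →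
  ∀ {z₁ z₂ a a′} (dist : Unique (z₁ ∷ z₂ ∷ a ∷ [])) (dist′ : Unique (z₁ ∷ z₂ ∷ a′ ∷ [])) →
  a ≢ a′ → (K : Cut G (Deletion.H dist)) (K′ : Cut G (Deletion.H dist′)) → a′ ∈ Cut.X K → ⊥
cuts-clash {n} G min cross {a = a} {a′} dist dist′ a≢a′ K K′ a′∈X =
  place-x (another X X-large a′)
  where
  module D = Deletion dist
  module D′ = Deletion dist′
  open D.CutFacts G min cross K
  module R = D.CutFacts (rev G) (rev-MinDegree G min) (rev-CrossDegree G cross) (reverse K)
  module F′ = D′.CutFacts G min cross K′

  into-H′ : ∀ {w} → w ∈ D.H → w ≢ a′ → w ∈ D′.H
  into-H′ w∈H w≢a′ = let (w≢z₁ , w≢z₂ , _) = D.H⇒Minus3 w∈H in D′.Minus3⇒H (w≢z₁ , w≢z₂ , w≢a′)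

  a∈H′ : a ∈ D′.H
  a∈H′ = let (a≢z₁ , a≢z₂) = last≢ dist in D′.Minus3⇒H (a≢z₁ , a≢z₂ , a≢a′)

  v≢a′ : v ≢ a′
  v≢a′ refl = disjoint a′∈X v∈Y

  -- A vertex in X ∩ Y′ forces |X′| ≥ |X| and |Y′| ≥ |Y| + 2, too many vertices.
  unbalanced : ∀ {x} → x ∈ X → x ∈ F′.Y → ⊥
  unbalanced {x} x∈X x∈Y′ = m+1+n≰m n (begin
    n + 2                 ≡⟨ cong (_+ 2) (sym size) ⟩
    p + q + 3 + 2         ≡⟨ shuffle p q ⟩
    p + (q + 2) + 3       ≤⟨ +-monoˡ-≤ 3 (+-mono-≤ p≤p′ q+2≤q′) ⟩
    F′.p + F′.q + 3       ≡⟨ F′.size ⟩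
    n                     ∎)
    where
    shuffle : ∀ x y → x + y + 3 + 2 ≡ x + (y + 2) + 3
    shuffle = solve-∀
    p≤p′ : p ≤ F′.p
    p≤p′ = +-cancelʳ-≤ 2 p F′.p (≤-trans (out-all F′.u) (F′.out-X F′.u∈X))
    q+2≤q′ : q + 2 ≤ F′.q
    q+2≤q′ = +-cancelʳ-≤ 2 (q + 2) F′.q (begin
      q + 2 + 2     ≡⟨ +-assoc q 2 2 ⟩
      q + 4         ≤⟨ in-X x∈X ⟩
      d⁻ G x        ≤⟨ F′.in-Y x∈Y′ ⟩
      F′.q + 2      ∎)

  -- v ∈ Y ∩ X′ has d⁺(v) + d⁻(v) ≤ |X′| + |Y| + 4 ≤ n + 1, against the minimum degree.
  overfull : v ∈ F′.X → ⊥
  overfull v∈X′ = m+1+n≰m (n + 1) (begin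
    n + 1 + 2                   ≡⟨ +-assoc n 1 2 ⟩
    n + 3                       ≤⟨ min v ⟩
    d⁺ G v + d⁻ G v             ≤⟨ +-mono-≤ (F′.out-X v∈X′) (in-Y v∈Y) ⟩
    F′.p + 2 + (q + 2)          ≤⟨ +-monoʳ-≤ (F′.p + 2) (+-monoˡ-≤ 2 q≤q′) ⟩
    F′.p + 2 + (F′.q + 2)       ≡⟨ shuffle F′.p F′.q ⟩
    F′.p + F′.q + 3 + 1         ≡⟨ cong (_+ 1) F′.size ⟩
    n + 1                       ∎)
    where
    shuffle : ∀ x y → x + 2 + (y + 2) ≡ x + y + 3 + 1
    shuffle = solve-∀
    q≤q′ : q ≤ F′.q
    q≤q′ = +-cancelʳ-≤ 2 q F′.q (≤-trans (R.out-all F′.v) (F′.in-Y F′.v∈Y))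

  -- With a ∈ X′: v ∈ Y′ is excluded since a → v, and v ∈ X′ by `overfull`.
  place-v : a ∈ F′.X → ⊥
  place-v a∈X′ with F′.cover (into-H′ (Y⊆S v∈Y) v≢a′)
  ... | inj₂ v∈Y′ = F′.no-edge a∈X′ v∈Y′ (R.X→a v∈Y)
  ... | inj₁ v∈X′ = overfull v∈X′

  -- With x ∈ X ∩ X′: a ∈ Y′ is excluded since x → a.
  place-a : ∀ {x} → x ∈ X → x ∈ F′.X → ⊥
  place-a x∈X x∈X′ with F′.cover a∈H′
  ... | inj₂ a∈Y′ = F′.no-edge x∈X′ a∈Y′ (X→a x∈X)
  ... | inj₁ a∈X′ = place-v a∈X′

  place-x : ∃[ x ] (x ∈ X × x ≢ a′) → ⊥
  place-x (x , x∈X , x≢a′) with F′.cover (into-H′ (X⊆S x∈X) x≢a′)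
  ... | inj₂ x∈Y′ = unbalanced x∈X x∈Y′
  ... | inj₁ x∈X′ = place-a x∈X x∈X′

-- a′ lies on one side of K; the Y-side case is the X-side case in the reverse digraph.
cuts-incompatible : ∀ {n} (G : Digraph n) → MinDegree G → CrossDegree G →
  ∀ {z₁ z₂ a a′} (dist : Unique (z₁ ∷ z₂ ∷ a ∷ [])) (dist′ : Unique (z₁ ∷ z₂ ∷ a′ ∷ [])) →
  a ≢ a′ → Cut G (Deletion.H dist) → Cut G (Deletion.H dist′) → ⊥
cuts-incompatible G min cross dist dist′ a≢a′ K K′ =
  [ (cuts-clash G min cross dist dist′ a≢a′ K K′)
  , (cuts-clash (rev G) (rev-MinDegree G min) (rev-CrossDegree G cross)
                dist dist′ a≢a′ (reverse K) (reverse K′))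
  ] (Cut.cover K a′∈H)
  where
  a′∈H : _ ∈ Deletion.H dist
  a′∈H = let (a′≢z₁ , a′≢z₂) = last≢ dist′ in
         Deletion.Minus3⇒H dist (a′≢z₁ , a′≢z₂ , a≢a′ ∘ sym)

-- For a non-edge z₁z₂, N⁺(z₁) ∪ N⁻(z₂) avoids z₁ and z₂, so by the cross condition
-- N⁺(z₁) ∩ N⁻(z₂) has at least (n + 1) - (n - 2) = 3 elements.
common-neighbours : ∀ {n} (G : Digraph n) → CrossDegree G → ∀ {z₁ z₂} →
  z₁ ≢ z₂ → ¬ Edge G z₁ z₂ → 3 ≤ ∣ N⁺ G z₁ ∩ N⁻ G z₂ ∣
common-neighbours {n} G cross {z₁} {z₂} z₁≢z₂ z₁↛z₂ =
  +-cancelˡ-≤ ∣ N⁺ G z₁ ∪ N⁻ G z₂ ∣ 3 _ (begin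
    ∣ N⁺ G z₁ ∪ N⁻ G z₂ ∣ + 3                         ≡⟨ +-assoc _ 2 1 ⟨
    ∣ N⁺ G z₁ ∪ N⁻ G z₂ ∣ + 2 + 1                     ≤⟨ +-monoˡ-≤ 1 union-small ⟩
    n + 1                                             ≤⟨ cross z₁ z₂ ⟩
    d⁺ G z₁ + d⁻ G z₂                                 ≡⟨ ∣∪∣+∣∩∣ (N⁺ G z₁) (N⁻ G z₂) ⟨
    ∣ N⁺ G z₁ ∪ N⁻ G z₂ ∣ + ∣ N⁺ G z₁ ∩ N⁻ G z₂ ∣     ∎)
  where
  ends : List (Fin n)
  ends = z₁ ∷ z₂ ∷ []
  avoids-ends : ∀ {w} → w ∈ N⁺ G z₁ ∪ N⁻ G z₂ → All (w ≢_) ends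
  avoids-ends w∈ with ∈∪⁻ w∈
  ... | inj₁ (mem z₁w) = (edge⇒≢ G z₁w ∘ sym) ∷ (λ { refl → z₁↛z₂ z₁w }) ∷ []
  ... | inj₂ (mem wz₂) = (λ { refl → z₁↛z₂ wz₂ }) ∷ edge⇒≢ G wz₂ ∷ []
  union-small : ∣ N⁺ G z₁ ∪ N⁻ G z₂ ∣ + 2 ≤ n
  union-small = begin
    ∣ N⁺ G z₁ ∪ N⁻ G z₂ ∣ + 2
      ≡⟨ cong (∣ N⁺ G z₁ ∪ N⁻ G z₂ ∣ +_) (∣⟦⟧∣ ((z₁≢z₂ ∷ []) ∷ [] ∷ [])) ⟨
    ∣ N⁺ G z₁ ∪ N⁻ G z₂ ∣ + ∣ ⟦ ends ⟧ ∣
      ≡⟨ ∣∪∣-disjoint (λ w∈ → ∉⟦⟧ (avoids-ends w∈)) ⟨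
    ∣ (N⁺ G z₁ ∪ N⁻ G z₂) ∪ ⟦ ends ⟧ ∣
      ≤⟨ ∣∣≤n _ ⟩
    n ∎

-- Two candidate apexes a ≠ a′: if neither works, their cuts are incompatible.
lemma9 : ∀ {n} (G : Digraph n)
    → (∀ x → outdeg G x + indeg G x ≥ ∣ G ∣ᵥ + 3)
    → (∀ x y → outdeg G x + indeg G y ≥ ∣ G ∣ᵥ + 1)
    → (z₁ z₂ : Fin n) → z₁ ≢ z₂ → ¬ Edge G z₁ z₂
    → Σ (Fin n) λ a → (Edge G z₁ a × Edge G a z₂)
    × StronglyConnected G (Minus3 z₁ z₂ a)
lemma9 {n} G h₁ h₂ z₁ z₂ z₁≢z₂ z₁↛z₂ =
  let (a , a∈C) = nonempty C (≤-trans (s≤s z≤n) three)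
      (a′ , a′∈C , a′≢a) = another C (≤-trans (n≤1+n 2) three) a
  in [ succeed-at a∈C
     , (λ K → [ succeed-at a′∈C
              , (λ K′ → ⊥-elim (cuts-incompatible G min cross (apex a∈C) (apex a′∈C) (a′≢a ∘ sym) K K′))
              ]′ (Deletion.connected-or-cut (apex a′∈C) G cross))
     ]′ (Deletion.connected-or-cut (apex a∈C) G cross)
  where
  min : MinDegree G
  min x = subst₂ (λ s t → n + 3 ≤ s + t) (outdeg≡d⁺ G x) (indeg≡d⁻ G x) (h₁ x)

  cross : CrossDegree G
  cross x y = subst₂ (λ s t → n + 1 ≤ s + t) (outdeg≡d⁺ G x) (indeg≡d⁻ G y) (h₂ x y)

  C : VSet n
  C = N⁺ G z₁ ∩ N⁻ G z₂

  three : 3 ≤ ∣ C ∣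
  three = common-neighbours G cross z₁≢z₂ z₁↛z₂

  apex-edges : ∀ {c} → c ∈ C → Edge G z₁ c × Edge G c z₂
  apex-edges c∈C = let (mem z₁c , mem cz₂) = ∈∩⁻ c∈C in z₁c , cz₂

  apex : ∀ {c} → c ∈ C → Unique (z₁ ∷ z₂ ∷ c ∷ [])
  apex c∈C = let (z₁c , cz₂) = apex-edges c∈C in
    (z₁≢z₂ ∷ edge⇒≢ G z₁c ∷ []) ∷ ((edge⇒≢ G cz₂ ∘ sym) ∷ []) ∷ [] ∷ []

  succeed-at : ∀ {c} → c ∈ C → StronglyConnected G (Minus3 z₁ z₂ c) →
    Σ (Fin n) λ a → (Edge G z₁ a × Edge G a z₂) × StronglyConnected G (Minus3 z₁ z₂ a)
  succeed-at c∈C connected = _ , apex-edges c∈C , connected
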